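{- Fix integers $n\ge 1$, $j\ge 0$, and a set $D\subseteq\{1,\dots,n-1\}$. Let $T_D$ be the set of standard Young tableaux with $n$ boxes, at most 2 columns, exactly $j$ entries in the second column, and descent set equal to $D$. Let $CW_D$ be the set of Catalan half-words $x_1\cdots x_n$ of length $n$ having exactly $j$ ones and such that $\{i\in\{1,\dots,n-1\} : x_ix_{i+1}=01\} = \{i\in\{1,\dots,n-1\} : n-i\notin D\}$. Then $|T_D| = |CW_D|$.
   Context: A Catalan half-word of length $n$ is a word $x_1\cdots x_n$ with $x_i\in\{0,1\}$ such that no initial segment contains more 1s than 0s (the total number of 1s may vary). A standard Young tableau with $n$ boxes is a filling of a Young diagram (drawn in French convention, rows stacked upward) with $1,\dots,n$, each once, increasing left to right along rows and bottom to top along columns. The descent set of a tableau $\tau$ is the set of $i$ such that $i+1$ lies in a strictly higher row than $i$. -}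

module Defs where

open import Data.Nat using (ℕ; zero; suc; _+_; _∸_; _≤_; _<_)
open import Data.Bool using (Bool; true; false)
open import Data.List using (List; []; _∷_; length; lookup; take; filter; upTo; map; _++_)
open import Data.List.Membership.Propositional using (_∈_; _∉_)
open import Data.List.Relation.Unary.Unique.Propositional using (Unique)
open import Data.List.Relation.Unary.AllPairs using (AllPairs)
open import Data.List.Relation.Binary.Permutation.Propositional using (_↭_)
open import Data.Fin using (Fin; toℕ; inject≤)
open import Data.Product using (Σ; _×_; _,_; ∃; ∃-syntax)
open import Data.Sum using (_⊎_)
open import Function.Bundles using (_⇔_)
open import Relation.Binary.PropositionalEquality using (_≡_)

HasCard : {A : Set} → (A → Set) → ℕ → Set
HasCard {A} P k =
  Σ (List A) λ xs → Unique xs × (∀ x → (x ∈ xs) ⇔ P x) × length xs ≡ k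

-- Tableaux with at most two columns (French convention).
-- A filling is given by its two columns, each listed bottom to top:
-- (col1 , col2).  Row r (0 = bottom row) consists of the r-th entry of
-- col1 and, if present, the r-th entry of col2.

Filling : Set
Filling = List ℕ × List ℕ

col1 : Filling → List ℕ
col1 (c , _) = c

col2 : Filling → List ℕ
col2 (_ , d) = d

record IsSYT (n : ℕ) (t : Filling) : Set where
  field
    shape     : length (col2 t) ≤ length (col1 t)
    entries   : (col1 t ++ col2 t) ↭ map suc (upTo n)
    col1-incr : AllPairs _<_ (col1 t)
    col2-incr : AllPairs _<_ (col2 t)
    row-incr  : (r : Fin (length (col2 t))) →
                lookup (col1 t) (inject≤ r shape) < lookup (col2 t) r

InRow : Filling → ℕ → ℕ → Set
InRow t v r =
    (∃[ k ] (toℕ {length (col1 t)} k ≡ r × lookup (col1 t) k ≡ v))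
  ⊎ (∃[ k ] (toℕ {length (col2 t)} k ≡ r × lookup (col2 t) k ≡ v))

IsDescent : Filling → ℕ → Set
IsDescent t i = ∃[ r ] ∃[ r' ] (InRow t i r × InRow t (suc i) r' × r < r')

InTD : (n j : ℕ) (D : List ℕ) → Filling → Set
InTD n j D t =
  IsSYT n t × length (col2 t) ≡ j × (∀ i → (i ∈ D) ⇔ IsDescent t i)

-- Catalan half-words: 0 = false, 1 = true.

ones : List Bool → ℕ
ones w = length (filter (Data.Bool._≟_ true) w)
  where import Data.Bool

zeros : List Bool → ℕ
zeros w = length (filter (Data.Bool._≟_ false) w)
  where import Data.Bool

IsCatalanHalfWord : ℕ → List Bool → Set
IsCatalanHalfWord n w =
  length w ≡ n × (∀ k → ones (take k w) ≤ zeros (take k w))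

-- the word has factor x_i x_{i+1} = 01 at 1-based position i
Has01At : List Bool → ℕ → Set
Has01At w i = ∃[ k ] (toℕ {length w} k ≡ i ∸ 1 × lookup w k ≡ false
                 × ∃[ k' ] (toℕ {length w} k' ≡ i × lookup w k' ≡ true))

InCWD : (n j : ℕ) (D : List ℕ) → List Bool → Set
InCWD n j D w =
  IsCatalanHalfWord n w × ones w ≡ j ×
  (∀ i → 1 ≤ i → i ≤ n ∸ 1 → (Has01At w i ⇔ (n ∸ i) ∉ D))

-- Reading a two-column standard tableau through the word y with y_v = 1 exactly when v lies
-- in the second column identifies these tableaux with Catalan half-words: the row of v is the
-- number of earlier letters equal to y_v, and i is a descent exactly when y_i y_(i+1) ≠ 01.
-- Mirroring every Dyck factor of a half-word (reverse and complement it, keeping the unmatched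
-- zeros in place) is an involution that preserves the length and the number of ones and moves
-- a factor 01 at position i to position n - i.  Hence w ↦ tableau (mirror w) maps CW_D
-- bijectively onto T_D.

module Submission where

open import Defs
open import Data.Nat using (ℕ; zero; suc; _+_; _∸_; _≤_; _<_; _>_; z≤n; s≤s; s≤s⁻¹; _≤?_)
open import Data.Nat.Properties hiding (_≟_)
import Data.Nat.Properties as ℕ
open import Data.Bool using (Bool; true; false; not; _∧_; if_then_else_)
open import Data.Bool.Properties using (_≟_; ∧-zeroʳ)
open import Data.List
  using (List; []; _∷_; _++_; [_]; length; reverse; filter; take; lookup; map; upTo; applyUpTo)
open import Data.List.Properties
open import Data.List.Relation.Unary.All as All using (All; []; _∷_)
open import Data.List.Relation.Unary.AllPairs as AllPairs using (AllPairs; []; _∷_)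
open import Data.List.Relation.Unary.Any using (here; there)
open import Data.List.Relation.Unary.Unique.Propositional using (Unique)
import Data.List.Relation.Unary.Unique.Propositional.Properties as Unique
open import Data.List.Membership.Propositional using (_∈_; _∉_)
open import Data.List.Membership.Propositional.Properties
  using (∈-++⁺ˡ; ∈-++⁺ʳ; ∈-++⁻; ∈-map⁺; ∈-map⁻; ∈-filter⁺; ∈-filter⁻)
open import Data.List.Membership.DecPropositional ℕ._≟_ using (_∈?_)
open import Data.List.Relation.Binary.Permutation.Propositional
  using (_↭_; prep; ↭-refl; ↭-trans; ↭-reflexive; ↭-sym; ↭⇒↭ₛ)
open import Data.List.Relation.Binary.Permutation.Propositional.Properties
  using (++⁺; ↭-length; filter-↭; shift; ∈-resp-↭) renaming (++-comm to ++-comm-↭)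
open import Data.List.Relation.Binary.Permutation.Setoid.Properties using (Unique-resp-↭)
open import Data.List.Relation.Binary.Prefix.Heterogeneous using (Prefix; []; _∷_)
open import Data.List.Relation.Binary.Prefix.Heterogeneous.Properties using (length-mono)
open import Data.Maybe using (Maybe; just; nothing)
open import Data.Fin using (toℕ; inject≤) renaming (zero to fzero; suc to fsuc)
open import Data.Product using (_×_; _,_; ∃-syntax; proj₁; proj₂; uncurry)
open import Data.Sum using (_⊎_; inj₁; inj₂)
open import Data.Empty using (⊥-elim)
open import Function.Bundles using (_⇔_; mk⇔; Equivalence)
open import Relation.Nullary using (¬_; Dec; does; yes; no; ¬?)
open import Relation.Nullary.Decidable
  using (map′; _×-dec_; _→-dec_; decidable-stable; dec-true; dec-false)
open import Relation.Binary.PropositionalEquality hiding ([_])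
open Equivalence using (to; from)

infix 4 _[_]=_

data _[_]=_ {A : Set} : List A → ℕ → A → Set where
  here  : ∀ {x xs} → x ∷ xs [ 0 ]= x
  there : ∀ {x xs r v} → xs [ r ]= v → x ∷ xs [ suc r ]= v

module _ {A : Set} where

  lookup⇒[]= : ∀ (xs : List A) {r v} →
               ∃[ k ] (toℕ {length xs} k ≡ r × lookup xs k ≡ v) → xs [ r ]= v
  lookup⇒[]= (x ∷ xs) (fzero  , refl , refl) = here
  lookup⇒[]= (x ∷ xs) (fsuc k , refl , refl) = there (lookup⇒[]= xs (k , refl , refl))

  []=⇒lookup : ∀ {xs : List A} {r v} →
               xs [ r ]= v → ∃[ k ] (toℕ {length xs} k ≡ r × lookup xs k ≡ v)
  []=⇒lookup here = fzero , refl , refl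
  []=⇒lookup (there p) with []=⇒lookup p
  ... | k , refl , refl = fsuc k , refl , refl

  []=-functional : ∀ {xs : List A} {r v w} → xs [ r ]= v → xs [ r ]= w → v ≡ w
  []=-functional here      here      = refl
  []=-functional (there p) (there q) = []=-functional p q

  []=⇒< : ∀ {xs : List A} {r v} → xs [ r ]= v → r < length xs
  []=⇒< here      = s≤s z≤n
  []=⇒< (there p) = s≤s ([]=⇒< p)

  <⇒[]= : ∀ (xs : List A) {r} → r < length xs → ∃[ v ] xs [ r ]= v
  <⇒[]= (x ∷ xs) {zero}  _         = x , here
  <⇒[]= (x ∷ xs) {suc r} (s≤s r<n) = proj₁ (<⇒[]= xs r<n) , there (proj₂ (<⇒[]= xs r<n))

  []=-++⁺ˡ : ∀ {xs : List A} ys {r v} → xs [ r ]= v → xs ++ ys [ r ]= v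
  []=-++⁺ˡ ys here      = here
  []=-++⁺ˡ ys (there p) = there ([]=-++⁺ˡ ys p)

  []=-++⁺ʳ : ∀ (xs : List A) {ys r v} → ys [ r ]= v → xs ++ ys [ length xs + r ]= v
  []=-++⁺ʳ []       p = p
  []=-++⁺ʳ (x ∷ xs) p = there ([]=-++⁺ʳ xs p)

  []=-++⁻ : ∀ (xs : List A) {ys r v} → xs ++ ys [ r ]= v →
            xs [ r ]= v ⊎ ∃[ s ] (r ≡ length xs + s × ys [ s ]= v)
  []=-++⁻ []       p         = inj₂ (_ , refl , p)
  []=-++⁻ (x ∷ xs) here      = inj₁ here
  []=-++⁻ (x ∷ xs) (there p) with []=-++⁻ xs p
  ... | inj₁ q              = inj₁ (there q)
  ... | inj₂ (s , refl , q) = inj₂ (s , refl , q)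

  []=-reverse⁺ : ∀ {xs : List A} {r v} → xs [ r ]= v → reverse xs [ length xs ∸ suc r ]= v
  []=-reverse⁺ {x ∷ xs} here =
    subst₂ (_[_]= x) (sym (unfold-reverse x xs)) eq ([]=-++⁺ʳ (reverse xs) here)
    where
    eq : length (reverse xs) + 0 ≡ length xs
    eq = trans (+-identityʳ _) (length-reverse xs)
  []=-reverse⁺ {x ∷ xs} (there p) =
    subst (_[ _ ]= _) (sym (unfold-reverse x xs)) ([]=-++⁺ˡ [ x ] ([]=-reverse⁺ p))

  []=-reverse⁻ : ∀ {xs : List A} {r v} → reverse xs [ r ]= v → xs [ length xs ∸ suc r ]= v
  []=-reverse⁻ {xs} {r} {v} p =
    subst₂ (_[_]= v) (reverse-involutive xs) (cong (_∸ suc r) (length-reverse xs)) ([]=-reverse⁺ p)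

  take-suc-[]= : ∀ {xs : List A} {m v} → xs [ m ]= v → take (suc m) xs ≡ take m xs ++ [ v ]
  take-suc-[]= here      = refl
  take-suc-[]= (there p) = cong (_ ∷_) (take-suc-[]= p)

  ∈⇒[]= : ∀ {v : A} {xs} → v ∈ xs → ∃[ r ] xs [ r ]= v
  ∈⇒[]= (here refl) = 0 , here
  ∈⇒[]= (there p)   = suc (proj₁ (∈⇒[]= p)) , there (proj₂ (∈⇒[]= p))

  []=⇒∈ : ∀ {v : A} {xs r} → xs [ r ]= v → v ∈ xs
  []=⇒∈ here      = here refl
  []=⇒∈ (there p) = there ([]=⇒∈ p)

count : Bool → List Bool → ℕ
count b xs = length (filter (b ≟_) xs)

count-++ : ∀ b xs ys → count b (xs ++ ys) ≡ count b xs + count b ys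
count-++ b xs ys = trans (cong length (filter-++ (b ≟_) xs ys)) (length-++ (filter (b ≟_) xs))

count-↭ : ∀ b {xs ys} → xs ↭ ys → count b xs ≡ count b ys
count-↭ b p = ↭-length (filter-↭ (b ≟_) p)

count-∷-≡ : ∀ b xs → count b (b ∷ xs) ≡ suc (count b xs)
count-∷-≡ b xs with b ≟ b
... | yes _  = refl
... | no b≢b = ⊥-elim (b≢b refl)

count-∷-≢ : ∀ {b x} xs → b ≢ x → count b (x ∷ xs) ≡ count b xs
count-∷-≢ {b} {x} xs b≢x with b ≟ x
... | yes b≡x = ⊥-elim (b≢x b≡x)
... | no  _   = refl

-- Ballot words and their first-return decomposition

data Ballot : ℕ → List Bool → Set where
  []  : ∀ {c} → Ballot c []
  0∷_ : ∀ {c w} → Ballot (suc c) w → Ballot c (false ∷ w)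
  1∷_ : ∀ {c w} → Ballot c w → Ballot (suc c) (true ∷ w)

Ballot⇒prefixes : ∀ {c w} → Ballot c w →
                  ∀ k → count true (take k w) ≤ c + count false (take k w)
Ballot⇒prefixes _      zero    = z≤n
Ballot⇒prefixes []     (suc k) = z≤n
Ballot⇒prefixes {c} {false ∷ w} (0∷ p) (suc k) =
  subst (count true (take k w) ≤_) (sym (+-suc c _)) (Ballot⇒prefixes p k)
Ballot⇒prefixes (1∷ p) (suc k) = s≤s (Ballot⇒prefixes p k)

prefixes⇒Ballot : ∀ c w →
                  (∀ k → count true (take k w) ≤ c + count false (take k w)) → Ballot c w
prefixes⇒Ballot c       []          _ = []
prefixes⇒Ballot c       (false ∷ w) f =
  0∷ prefixes⇒Ballot (suc c) w (λ k → subst (count true (take k w) ≤_) (+-suc c _) (f (suc k)))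
prefixes⇒Ballot zero    (true ∷ w)  f with f 1
... | ()
prefixes⇒Ballot (suc c) (true ∷ w)  f = 1∷ prefixes⇒Ballot c w (λ k → s≤s⁻¹ (f (suc k)))

Ballot? : ∀ c w → Dec (Ballot c w)
Ballot? c       []          = yes []
Ballot? c       (false ∷ w) = map′ 0∷_ (λ { (0∷ p) → p }) (Ballot? (suc c) w)
Ballot? zero    (true ∷ w)  = no λ ()
Ballot? (suc c) (true ∷ w)  = map′ 1∷_ (λ { (1∷ p) → p }) (Ballot? c w)

-- h counts the unmatched zeros; `matched` is the first-return decomposition.
data HalfDyck : ℕ → List Bool → Set where
  []        : HalfDyck 0 []
  matched   : ∀ {h u v} → HalfDyck 0 u → HalfDyck h v → HalfDyck h (false ∷ u ++ true ∷ v)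
  unmatched : ∀ {h v} → HalfDyck h v → HalfDyck (suc h) (false ∷ v)

Dyck : List Bool → Set
Dyck = HalfDyck 0

HalfDyck-++ : ∀ {h a c} → HalfDyck h a → Dyck c → HalfDyck h (a ++ c)
HalfDyck-++ []              r = r
HalfDyck-++ {c = c} (matched {u = u} {v} p q) r
  rewrite ++-assoc u (true ∷ v) c = matched p (HalfDyck-++ q r)
HalfDyck-++ (unmatched q)   r = unmatched (HalfDyck-++ q r)

HalfDyck-∷ʳ-false : ∀ {h a} → HalfDyck h a → HalfDyck (suc h) (a ++ [ false ])
HalfDyck-∷ʳ-false []                          = unmatched []
HalfDyck-∷ʳ-false (matched {u = u} {v} p q)
  rewrite ++-assoc u (true ∷ v) [ false ]    = matched p (HalfDyck-∷ʳ-false q)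
HalfDyck-∷ʳ-false (unmatched q)               = unmatched (HalfDyck-∷ʳ-false q)

HalfDyck-∷ʳ-true : ∀ {h a} → HalfDyck (suc h) a → HalfDyck h (a ++ [ true ])
HalfDyck-∷ʳ-true (matched {u = u} {v} p q)
  rewrite ++-assoc u (true ∷ v) [ true ]   = matched p (HalfDyck-∷ʳ-true q)
HalfDyck-∷ʳ-true {zero}  (unmatched q)      = matched q []
HalfDyck-∷ʳ-true {suc h} (unmatched q)      = unmatched (HalfDyck-∷ʳ-true q)

Ballot-++ : ∀ {u} → Dyck u → ∀ {c r} → Ballot c r → Ballot c (u ++ r)
Ballot-++ []                  b = b
Ballot-++ (matched {u = u} {v} p q) {r = r} b
  rewrite ++-assoc u (true ∷ v) r = 0∷ Ballot-++ p (1∷ Ballot-++ q b)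

HalfDyck⇒Ballot : ∀ {h y} → HalfDyck h y → ∀ c → Ballot c y
HalfDyck⇒Ballot []            c = []
HalfDyck⇒Ballot (matched p q) c = 0∷ Ballot-++ p (1∷ HalfDyck⇒Ballot q c)
HalfDyck⇒Ballot (unmatched q) c = 0∷ HalfDyck⇒Ballot q (suc c)

HalfDyck-++-Ballot : ∀ {a h} → HalfDyck h a → ∀ b → Ballot h b → ∃[ h′ ] HalfDyck h′ (a ++ b)
HalfDyck-++-Ballot {a} p [] [] = _ , subst (HalfDyck _) (sym (++-identityʳ a)) p
HalfDyck-++-Ballot {a} p (false ∷ b) (0∷ w) with HalfDyck-++-Ballot (HalfDyck-∷ʳ-false p) b w
... | h′ , r = h′ , subst (HalfDyck h′) (++-assoc a [ false ] b) r
HalfDyck-++-Ballot {a} p (true ∷ b)  (1∷ w) with HalfDyck-++-Ballot (HalfDyck-∷ʳ-true p) b w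
... | h′ , r = h′ , subst (HalfDyck h′) (++-assoc a [ true ] b) r

Ballot⇒HalfDyck : ∀ {y} → Ballot 0 y → ∃[ h ] HalfDyck h y
Ballot⇒HalfDyck {y} = HalfDyck-++-Ballot [] y

-- The mirror involution

Split : Set
Split = Maybe (List Bool × List Bool)

prependLeft : List Bool → Split → Split
prependLeft a nothing        = nothing
prependLeft a (just (u , v)) = just (a ++ u , v)

prependLeft-[] : ∀ m → prependLeft [] m ≡ m
prependLeft-[] nothing  = refl
prependLeft-[] (just _) = refl

prependLeft-++ : ∀ a b m → prependLeft a (prependLeft b m) ≡ prependLeft (a ++ b) m
prependLeft-++ a b nothing        = refl
prependLeft-++ a b (just (u , v)) = cong (λ z → just (z , v)) (sym (++-assoc a b u))

splitAtMatch : ℕ → List Bool → Split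
splitAtMatch c       []          = nothing
splitAtMatch c       (false ∷ w) = prependLeft [ false ] (splitAtMatch (suc c) w)
splitAtMatch zero    (true ∷ w)  = just ([] , w)
splitAtMatch (suc c) (true ∷ w)  = prependLeft [ true ] (splitAtMatch c w)

splitAtMatch-Dyck-++ : ∀ {u} → Dyck u → ∀ c r →
                       splitAtMatch c (u ++ r) ≡ prependLeft u (splitAtMatch c r)
splitAtMatch-Dyck-++ [] c r = sym (prependLeft-[] _)
splitAtMatch-Dyck-++ (matched {u = a} {b} p q) c r = begin
  prependLeft [ false ] (splitAtMatch (suc c) ((a ++ true ∷ b) ++ r))
    ≡⟨ cong (λ z → prependLeft [ false ] (splitAtMatch (suc c) z)) (++-assoc a (true ∷ b) r) ⟩
  prependLeft [ false ] (splitAtMatch (suc c) (a ++ true ∷ b ++ r))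
    ≡⟨ cong (prependLeft [ false ]) (splitAtMatch-Dyck-++ p (suc c) (true ∷ b ++ r)) ⟩
  prependLeft [ false ] (prependLeft a (prependLeft [ true ] (splitAtMatch c (b ++ r))))
    ≡⟨ cong (λ z → prependLeft [ false ] (prependLeft a (prependLeft [ true ] z)))
         (splitAtMatch-Dyck-++ q c r) ⟩
  prependLeft [ false ] (prependLeft a (prependLeft [ true ] (prependLeft b (splitAtMatch c r))))
    ≡⟨ cong (λ z → prependLeft [ false ] (prependLeft a z)) (prependLeft-++ [ true ] b _) ⟩
  prependLeft [ false ] (prependLeft a (prependLeft (true ∷ b) (splitAtMatch c r)))
    ≡⟨ cong (prependLeft [ false ]) (prependLeft-++ a (true ∷ b) _) ⟩
  prependLeft [ false ] (prependLeft (a ++ true ∷ b) (splitAtMatch c r))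
    ≡⟨ prependLeft-++ [ false ] (a ++ true ∷ b) _ ⟩
  prependLeft (false ∷ a ++ true ∷ b) (splitAtMatch c r) ∎
  where open ≡-Reasoning

splitAtMatch-HalfDyck : ∀ {h v} → HalfDyck h v → ∀ c → splitAtMatch c v ≡ nothing
splitAtMatch-HalfDyck []            c = refl
splitAtMatch-HalfDyck (matched {u = u} {v} p q) c = begin
  prependLeft [ false ] (splitAtMatch (suc c) (u ++ true ∷ v))
    ≡⟨ cong (prependLeft [ false ]) (splitAtMatch-Dyck-++ p (suc c) (true ∷ v)) ⟩
  prependLeft [ false ] (prependLeft u (prependLeft [ true ] (splitAtMatch c v)))
    ≡⟨ cong (λ z → prependLeft [ false ] (prependLeft u (prependLeft [ true ] z)))
         (splitAtMatch-HalfDyck q c) ⟩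
  nothing ∎
  where open ≡-Reasoning
splitAtMatch-HalfDyck (unmatched q) c = cong (prependLeft [ false ]) (splitAtMatch-HalfDyck q (suc c))

splitAtMatch-matched : ∀ {u} → Dyck u → ∀ v → splitAtMatch 0 (u ++ true ∷ v) ≡ just (u , v)
splitAtMatch-matched {u} p v =
  trans (splitAtMatch-Dyck-++ p 0 (true ∷ v)) (cong (λ z → just (z , v)) (++-identityʳ u))

-- On Dyck words this is reversal followed by complementation (the mirror image of the path);
-- unmatched zeros stay zeros.  The fuel only makes the recursion structural.
mirrorWithin : ℕ → List Bool → List Bool
mirrorWithin zero    _           = []
mirrorWithin (suc f) []          = []
mirrorWithin (suc f) (true ∷ w)  = []
mirrorWithin (suc f) (false ∷ w) with splitAtMatch 0 w
... | nothing      = mirrorWithin f w ++ [ false ]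
... | just (u , v) = mirrorWithin f v ++ false ∷ mirrorWithin f u ++ [ true ]

mirror : List Bool → List Bool
mirror w = mirrorWithin (suc (length w)) w

mirrorOf : ∀ {h y} → HalfDyck h y → List Bool
mirrorOf []            = []
mirrorOf (matched p q) = mirrorOf q ++ false ∷ mirrorOf p ++ [ true ]
mirrorOf (unmatched q) = mirrorOf q ++ [ false ]

mirrorWithin-HalfDyck : ∀ {h y} (p : HalfDyck h y) f → length y < f → mirrorWithin f y ≡ mirrorOf p
mirrorWithin-HalfDyck []            (suc f) _ = refl
mirrorWithin-HalfDyck (matched {u = u} {v} p q) (suc f) (s≤s len<f)
  rewrite splitAtMatch-matched p v =
    cong₂ (λ a b → a ++ false ∷ b ++ [ true ])
      (mirrorWithin-HalfDyck q f (≤-<-trans (≤-trans (n≤1+n _) (m≤n+m _ _)) u1v<f))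
      (mirrorWithin-HalfDyck p f (≤-<-trans (m≤m+n _ _) u1v<f))
  where
  u1v<f : length u + suc (length v) < f
  u1v<f = subst (_< f) (length-++ u) len<f
mirrorWithin-HalfDyck (unmatched {v = v} q) (suc f) (s≤s len<f)
  rewrite splitAtMatch-HalfDyck q 0 = cong (_++ [ false ]) (mirrorWithin-HalfDyck q f len<f)

mirror≡mirrorOf : ∀ {h y} (p : HalfDyck h y) → mirror y ≡ mirrorOf p
mirror≡mirrorOf p = mirrorWithin-HalfDyck p _ ≤-refl

mirror-matched : ∀ {h u v} → Dyck u → HalfDyck h v →
                 mirror (false ∷ u ++ true ∷ v) ≡ mirror v ++ false ∷ mirror u ++ [ true ]
mirror-matched p q = trans (mirror≡mirrorOf (matched p q))
  (sym (cong₂ (λ a b → a ++ false ∷ b ++ [ true ]) (mirror≡mirrorOf q) (mirror≡mirrorOf p)))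

mirror-unmatched : ∀ {h v} → HalfDyck h v → mirror (false ∷ v) ≡ mirror v ++ [ false ]
mirror-unmatched q =
  trans (mirror≡mirrorOf (unmatched q)) (cong (_++ [ false ]) (sym (mirror≡mirrorOf q)))

HalfDyck-mirror : ∀ {h y} → HalfDyck h y → HalfDyck h (mirror y)
HalfDyck-mirror [] = []
HalfDyck-mirror (matched p q) =
  subst (HalfDyck _) (sym (mirror-matched p q))
    (HalfDyck-++ (HalfDyck-mirror q) (matched (HalfDyck-mirror p) []))
HalfDyck-mirror (unmatched q) =
  subst (HalfDyck _) (sym (mirror-unmatched q)) (HalfDyck-∷ʳ-false (HalfDyck-mirror q))

mirror-++ : ∀ {h a c} → HalfDyck h a → Dyck c → mirror (a ++ c) ≡ mirror c ++ mirror a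
mirror-++ {c = c} [] r = sym (++-identityʳ (mirror c))
mirror-++ {c = c} (matched {u = u} {v} p q) r = begin
  mirror (false ∷ (u ++ true ∷ v) ++ c)
    ≡⟨ cong (λ z → mirror (false ∷ z)) (++-assoc u (true ∷ v) c) ⟩
  mirror (false ∷ u ++ true ∷ v ++ c)
    ≡⟨ mirror-matched p (HalfDyck-++ q r) ⟩
  mirror (v ++ c) ++ false ∷ mirror u ++ [ true ]
    ≡⟨ cong (_++ false ∷ mirror u ++ [ true ]) (mirror-++ q r) ⟩
  (mirror c ++ mirror v) ++ false ∷ mirror u ++ [ true ]
    ≡⟨ ++-assoc (mirror c) (mirror v) _ ⟩
  mirror c ++ mirror v ++ false ∷ mirror u ++ [ true ]
    ≡⟨ cong (mirror c ++_) (sym (mirror-matched p q)) ⟩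
  mirror c ++ mirror (false ∷ u ++ true ∷ v) ∎
  where open ≡-Reasoning
mirror-++ {c = c} (unmatched {v = v} q) r = begin
  mirror (false ∷ v ++ c)               ≡⟨ mirror-unmatched (HalfDyck-++ q r) ⟩
  mirror (v ++ c) ++ [ false ]          ≡⟨ cong (_++ [ false ]) (mirror-++ q r) ⟩
  (mirror c ++ mirror v) ++ [ false ]   ≡⟨ ++-assoc (mirror c) (mirror v) _ ⟩
  mirror c ++ mirror v ++ [ false ]     ≡⟨ cong (mirror c ++_) (sym (mirror-unmatched q)) ⟩
  mirror c ++ mirror (false ∷ v)        ∎
  where open ≡-Reasoning

mirror-∷ʳ-false : ∀ {h a} → HalfDyck h a → mirror (a ++ [ false ]) ≡ false ∷ mirror a
mirror-∷ʳ-false [] = refl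
mirror-∷ʳ-false (matched {u = u} {v} p q) = begin
  mirror (false ∷ (u ++ true ∷ v) ++ [ false ])
    ≡⟨ cong (λ z → mirror (false ∷ z)) (++-assoc u (true ∷ v) [ false ]) ⟩
  mirror (false ∷ u ++ true ∷ v ++ [ false ])
    ≡⟨ mirror-matched p (HalfDyck-∷ʳ-false q) ⟩
  mirror (v ++ [ false ]) ++ false ∷ mirror u ++ [ true ]
    ≡⟨ cong (_++ false ∷ mirror u ++ [ true ]) (mirror-∷ʳ-false q) ⟩
  false ∷ mirror v ++ false ∷ mirror u ++ [ true ]
    ≡⟨ cong (false ∷_) (sym (mirror-matched p q)) ⟩
  false ∷ mirror (false ∷ u ++ true ∷ v) ∎
  where open ≡-Reasoning
mirror-∷ʳ-false (unmatched {v = v} q) = begin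
  mirror (false ∷ v ++ [ false ])        ≡⟨ mirror-unmatched (HalfDyck-∷ʳ-false q) ⟩
  mirror (v ++ [ false ]) ++ [ false ]   ≡⟨ cong (_++ [ false ]) (mirror-∷ʳ-false q) ⟩
  false ∷ mirror v ++ [ false ]          ≡⟨ cong (false ∷_) (sym (mirror-unmatched q)) ⟩
  false ∷ mirror (false ∷ v)             ∎
  where open ≡-Reasoning

mirror-involutive : ∀ {h y} → HalfDyck h y → mirror (mirror y) ≡ y
mirror-involutive [] = refl
mirror-involutive (matched {u = u} {v} p q) = begin
  mirror (mirror (false ∷ u ++ true ∷ v))
    ≡⟨ cong mirror (mirror-matched p q) ⟩
  mirror (mirror v ++ false ∷ mirror u ++ [ true ])
    ≡⟨ mirror-++ (HalfDyck-mirror q) (matched (HalfDyck-mirror p) []) ⟩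
  mirror (false ∷ mirror u ++ [ true ]) ++ mirror (mirror v)
    ≡⟨ cong₂ _++_ (mirror-matched (HalfDyck-mirror p) []) (mirror-involutive q) ⟩
  (false ∷ mirror (mirror u) ++ [ true ]) ++ v
    ≡⟨ cong (λ z → (false ∷ z ++ [ true ]) ++ v) (mirror-involutive p) ⟩
  (false ∷ u ++ [ true ]) ++ v
    ≡⟨ cong (false ∷_) (++-assoc u [ true ] v) ⟩
  false ∷ u ++ true ∷ v ∎
  where open ≡-Reasoning
mirror-involutive (unmatched {v = v} q) = begin
  mirror (mirror (false ∷ v))         ≡⟨ cong mirror (mirror-unmatched q) ⟩
  mirror (mirror v ++ [ false ])      ≡⟨ mirror-∷ʳ-false (HalfDyck-mirror q) ⟩
  false ∷ mirror (mirror v)           ≡⟨ cong (false ∷_) (mirror-involutive q) ⟩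
  false ∷ v                           ∎
  where open ≡-Reasoning

mirror-↭ : ∀ {h y} → HalfDyck h y → mirror y ↭ y
mirror-↭ [] = ↭-refl
mirror-↭ (matched {u = u} {v} p q) rewrite mirror-matched p q =
  ↭-trans (++-comm-↭ (mirror v) (false ∷ mirror u ++ [ true ]))
    (↭-trans (++⁺ (prep false (++⁺ (mirror-↭ p) ↭-refl)) (mirror-↭ q))
      (↭-reflexive (cong (false ∷_) (++-assoc u [ true ] v))))
mirror-↭ (unmatched {v = v} q) rewrite mirror-unmatched q =
  ↭-trans (++-comm-↭ (mirror v) [ false ]) (prep false (mirror-↭ q))

length-mirror : ∀ {h y} → HalfDyck h y → length (mirror y) ≡ length y
length-mirror p = ↭-length (mirror-↭ p)

count-mirror : ∀ b {h y} → HalfDyck h y → count b (mirror y) ≡ count b y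
count-mirror b p = count-↭ b (mirror-↭ p)

-- Factors 01 under mirroring

Peak : List Bool → ℕ → Set
Peak y i = y [ i ∸ 1 ]= false × y [ i ]= true

marks : Bool → List Bool → List Bool
marks p []       = []
marks p (x ∷ xs) = (not p ∧ x) ∷ marks x xs

-- Padded to length (length y + 1), so that reversal realises the reflection i ↦ length y ∸ i.
peakMarks : List Bool → List Bool
peakMarks y = marks true y ++ [ false ]

closedMarks : List Bool → List Bool
closedMarks u = marks false (u ++ [ true ])

lastOr : Bool → List Bool → Bool
lastOr p []       = p
lastOr p (x ∷ xs) = lastOr x xs

lastOr-++ : ∀ p a b → lastOr p (a ++ b) ≡ lastOr (lastOr p a) b
lastOr-++ p []      b = refl
lastOr-++ p (x ∷ a) b = lastOr-++ x a b

marks-++ : ∀ p a b → marks p (a ++ b) ≡ marks p a ++ marks (lastOr p a) b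
marks-++ p []      b = refl
marks-++ p (x ∷ a) b = cong ((not p ∧ x) ∷_) (marks-++ x a b)

length-marks : ∀ p xs → length (marks p xs) ≡ length xs
length-marks p []       = refl
length-marks p (x ∷ xs) = cong suc (length-marks x xs)

length-peakMarks : ∀ y → length (peakMarks y) ≡ suc (length y)
length-peakMarks y = trans (length-++ (marks true y)) (trans (+-comm _ 1) (cong suc (length-marks true y)))

marks-HalfDyck : ∀ {h v} → HalfDyck h v → marks false v ≡ marks true v
marks-HalfDyck []            = refl
marks-HalfDyck (matched _ _) = refl
marks-HalfDyck (unmatched _) = refl

lastOr-Dyck : ∀ {d} → Dyck d → lastOr true d ≡ true
lastOr-Dyck [] = refl
lastOr-Dyck (matched {u = u} {v} _ q) = trans (lastOr-++ false u (true ∷ v)) (lastOr-Dyck q)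

closedMarks-Dyck : ∀ {u} → Dyck u → u ≡ [] ⊎ closedMarks u ≡ peakMarks u
closedMarks-Dyck []                          = inj₁ refl
closedMarks-Dyck (matched {u = a} {b} p q) = inj₂ (begin
  false ∷ marks false ((a ++ true ∷ b) ++ [ true ])
    ≡⟨ cong (false ∷_) (marks-++ false (a ++ true ∷ b) [ true ]) ⟩
  false ∷ marks false (a ++ true ∷ b) ++ [ not (lastOr false (a ++ true ∷ b)) ∧ true ]
    ≡⟨ cong (λ z → false ∷ marks false (a ++ true ∷ b) ++ [ not z ∧ true ])
         (trans (lastOr-++ false a (true ∷ b)) (lastOr-Dyck q)) ⟩
  false ∷ marks false (a ++ true ∷ b) ++ [ false ] ∎)
  where open ≡-Reasoning

peakMarks-matched : ∀ u v → peakMarks (false ∷ u ++ true ∷ v) ≡ false ∷ closedMarks u ++ peakMarks v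
peakMarks-matched u v = cong (false ∷_) (begin
  marks false (u ++ true ∷ v) ++ [ false ]
    ≡⟨ cong (λ z → marks false z ++ [ false ]) (sym (++-assoc u [ true ] v)) ⟩
  marks false ((u ++ [ true ]) ++ v) ++ [ false ]
    ≡⟨ cong (_++ [ false ]) (marks-++ false (u ++ [ true ]) v) ⟩
  (closedMarks u ++ marks (lastOr false (u ++ [ true ])) v) ++ [ false ]
    ≡⟨ cong (λ z → (closedMarks u ++ marks z v) ++ [ false ]) (lastOr-++ false u [ true ]) ⟩
  (closedMarks u ++ marks true v) ++ [ false ]
    ≡⟨ ++-assoc (closedMarks u) _ _ ⟩
  closedMarks u ++ peakMarks v ∎)
  where open ≡-Reasoning

peakMarks-++-matched : ∀ a b →
                       peakMarks (a ++ false ∷ b ++ [ true ]) ≡ peakMarks a ++ closedMarks b ++ [ false ]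
peakMarks-++-matched a b = begin
  marks true (a ++ false ∷ b ++ [ true ]) ++ [ false ]
    ≡⟨ cong (_++ [ false ]) (marks-++ true a _) ⟩
  (marks true a ++ (not (lastOr true a) ∧ false) ∷ closedMarks b) ++ [ false ]
    ≡⟨ cong (λ z → (marks true a ++ z ∷ closedMarks b) ++ [ false ]) (∧-zeroʳ _) ⟩
  (marks true a ++ false ∷ closedMarks b) ++ [ false ]
    ≡⟨ ++-assoc (marks true a) _ _ ⟩
  marks true a ++ false ∷ closedMarks b ++ [ false ]
    ≡⟨ sym (++-assoc (marks true a) [ false ] _) ⟩
  peakMarks a ++ closedMarks b ++ [ false ] ∎
  where open ≡-Reasoning

closedMarks-mirror : ∀ {u} → Dyck u → peakMarks (mirror u) ≡ reverse (peakMarks u) →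
                     closedMarks (mirror u) ≡ reverse (closedMarks u)
closedMarks-mirror {u} p ih with closedMarks-Dyck p | closedMarks-Dyck (HalfDyck-mirror p)
... | inj₁ refl | _          = refl
... | inj₂ e    | inj₂ e′    = trans e′ (trans ih (cong reverse (sym e)))
... | inj₂ e    | inj₁ mu≡[] with trans (sym (mirror-involutive p)) (cong mirror mu≡[])
...   | refl with e
...     | ()

peakMarks-mirror : ∀ {h y} → HalfDyck h y → peakMarks (mirror y) ≡ reverse (peakMarks y)
peakMarks-mirror [] = refl
peakMarks-mirror (matched {u = u} {v} p q) = begin
  peakMarks (mirror (false ∷ u ++ true ∷ v))
    ≡⟨ cong peakMarks (mirror-matched p q) ⟩
  peakMarks (mirror v ++ false ∷ mirror u ++ [ true ])
    ≡⟨ peakMarks-++-matched (mirror v) (mirror u) ⟩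
  peakMarks (mirror v) ++ closedMarks (mirror u) ++ [ false ]
    ≡⟨ cong₂ (λ a b → a ++ b ++ [ false ])
         (peakMarks-mirror q) (closedMarks-mirror p (peakMarks-mirror p)) ⟩
  reverse (peakMarks v) ++ reverse (closedMarks u) ++ [ false ]
    ≡⟨ cong (reverse (peakMarks v) ++_) (sym (unfold-reverse false (closedMarks u))) ⟩
  reverse (peakMarks v) ++ reverse (false ∷ closedMarks u)
    ≡⟨ sym (reverse-++ (false ∷ closedMarks u) (peakMarks v)) ⟩
  reverse (false ∷ closedMarks u ++ peakMarks v)
    ≡⟨ cong reverse (sym (peakMarks-matched u v)) ⟩
  reverse (peakMarks (false ∷ u ++ true ∷ v)) ∎
  where open ≡-Reasoning
peakMarks-mirror (unmatched {v = v} q) = begin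
  peakMarks (mirror (false ∷ v))
    ≡⟨ cong peakMarks (mirror-unmatched q) ⟩
  marks true (mirror v ++ [ false ]) ++ [ false ]
    ≡⟨ cong (_++ [ false ]) (marks-++ true (mirror v) _) ⟩
  (marks true (mirror v) ++ [ not (lastOr true (mirror v)) ∧ false ]) ++ [ false ]
    ≡⟨ cong (λ z → (marks true (mirror v) ++ [ z ]) ++ [ false ]) (∧-zeroʳ _) ⟩
  peakMarks (mirror v) ++ [ false ]
    ≡⟨ cong (_++ [ false ]) (peakMarks-mirror q) ⟩
  reverse (peakMarks v) ++ [ false ]
    ≡⟨ sym (unfold-reverse false (peakMarks v)) ⟩
  reverse (false ∷ peakMarks v)
    ≡⟨ cong (λ z → reverse (false ∷ z ++ [ false ])) (sym (marks-HalfDyck q)) ⟩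
  reverse (peakMarks (false ∷ v)) ∎
  where open ≡-Reasoning

marks-[]=⁺ : ∀ p xs m → xs [ m ]= false → xs [ suc m ]= true → marks p xs [ suc m ]= true
marks-[]=⁺ p (false ∷ true ∷ xs) zero    here      (there here) = there here
marks-[]=⁺ p (x ∷ xs)            (suc m) (there a) (there b)    = there (marks-[]=⁺ x xs m a b)

marks-[]=⁻ : ∀ p xs m → marks p xs [ suc m ]= true → xs [ m ]= false × xs [ suc m ]= true
marks-[]=⁻ p (false ∷ true ∷ xs)  zero (there here) = here , there here
marks-[]=⁻ p (false ∷ false ∷ xs) zero (there ())
marks-[]=⁻ p (true ∷ x ∷ xs)      zero (there a) with x | a
... | true  | ()
... | false | ()
marks-[]=⁻ p (x ∷ xs) (suc m) (there a) with marks-[]=⁻ x xs m a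
... | b , c = there b , there c

Peak⇒peakMarks : ∀ y i → Peak y (suc i) → peakMarks y [ suc i ]= true
Peak⇒peakMarks y i (a , b) = []=-++⁺ˡ [ false ] (marks-[]=⁺ true y i a b)

peakMarks⇒Peak : ∀ y i → peakMarks y [ suc i ]= true → Peak y (suc i)
peakMarks⇒Peak y i a with []=-++⁻ (marks true y) a
... | inj₁ b                       = marks-[]=⁻ true y i b
... | inj₂ (zero    , _ , ())
... | inj₂ (suc _   , _ , there ())

Peak-reflect : ∀ {a b n} → peakMarks a ≡ reverse (peakMarks b) → length b ≡ n →
               ∀ {i} → 1 ≤ i → i ≤ n ∸ 1 → Peak a i → Peak b (n ∸ i)
Peak-reflect {a} {b} {suc n} marks≡ len {suc i} (s≤s z≤n) i<n peak
  with n ∸ i in n-i≡ | m<n⇒0<n∸m i<n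
... | suc m | _ = peakMarks⇒Peak b m (subst (peakMarks b [_]= true) index
                    ([]=-reverse⁻ (subst (_[ suc i ]= true) marks≡ (Peak⇒peakMarks a i peak))))
  where
  index : length (peakMarks b) ∸ suc (suc i) ≡ suc m
  index = trans (cong (_∸ suc (suc i)) (trans (length-peakMarks b) (cong suc len))) n-i≡

[]=? : ∀ (xs : List Bool) r v → Dec (xs [ r ]= v)
[]=? []       r       v = no λ ()
[]=? (x ∷ xs) zero    v with x ≟ v
... | yes refl = yes here
... | no  x≢v  = no λ { here → x≢v refl }
[]=? (x ∷ xs) (suc r) v = map′ there (λ { (there p) → p }) ([]=? xs r v)

Peak? : ∀ y i → Dec (Peak y i)
Peak? y i = []=? y (i ∸ 1) false ×-dec []=? y i true

Has01At⇔Peak : ∀ w i → Has01At w i ⇔ Peak w i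
Has01At⇔Peak w i = mk⇔
  (λ (k , k≡ , wk , k′ , k′≡ , wk′) → lookup⇒[]= w (k , k≡ , wk) , lookup⇒[]= w (k′ , k′≡ , wk′))
  (λ (p , q) → let k , k≡ , wk = []=⇒lookup p ; k′ , k′≡ , wk′ = []=⇒lookup q in
     k , k≡ , wk , k′ , k′≡ , wk′)

Has01At? : ∀ w i → Dec (Has01At w i)
Has01At? w i = map′ (from (Has01At⇔Peak w i)) (to (Has01At⇔Peak w i)) (Peak? w i)

-- Two-column tableaux as words

positions : Bool → ℕ → List Bool → List ℕ
positions b i []       = []
positions b i (x ∷ xs) =
  if does (b ≟ x) then i ∷ positions b (suc i) xs else positions b (suc i) xs

length-positions : ∀ b i xs → length (positions b i xs) ≡ count b xs
length-positions b i []       = refl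
length-positions b i (x ∷ xs) with b ≟ x
... | yes _ = cong suc (length-positions b (suc i) xs)
... | no  _ = length-positions b (suc i) xs

positions-≥ : ∀ b i xs → All (i ≤_) (positions b i xs)
positions-≥ b i []       = []
positions-≥ b i (x ∷ xs) with b ≟ x
... | yes _ = ≤-refl ∷ All.map (≤-trans (n≤1+n i)) (positions-≥ b (suc i) xs)
... | no  _ = All.map (≤-trans (n≤1+n i)) (positions-≥ b (suc i) xs)

positions-increasing : ∀ b i xs → AllPairs _<_ (positions b i xs)
positions-increasing b i []       = []
positions-increasing b i (x ∷ xs) with b ≟ x
... | yes _ = positions-≥ b (suc i) xs ∷ positions-increasing b (suc i) xs
... | no  _ = positions-increasing b (suc i) xs

positions-[]=⁻ : ∀ b i xs {r v} → positions b i xs [ r ]= v →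
                 ∃[ m ] (v ≡ i + m × xs [ m ]= b × count b (take m xs) ≡ r)
positions-[]=⁻ b i (x ∷ xs) p with b ≟ x | p
... | yes refl | here    = 0 , sym (+-identityʳ i) , here , refl
... | yes refl | there q with positions-[]=⁻ b (suc i) xs q
...   | m , refl , a , refl = suc m , sym (+-suc i m) , there a , count-∷-≡ b (take m xs)
positions-[]=⁻ b i (x ∷ xs) p | no b≢x | q with positions-[]=⁻ b (suc i) xs q
...   | m , refl , a , refl = suc m , sym (+-suc i m) , there a , count-∷-≢ (take m xs) b≢x

positions-[]=⁺ : ∀ b i xs m → xs [ m ]= b → positions b i xs [ count b (take m xs) ]= i + m
positions-[]=⁺ b i (x ∷ xs) zero    here with b ≟ x
... | yes _  = subst (i ∷ positions b (suc i) xs [ 0 ]=_) (sym (+-identityʳ i)) here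
... | no b≢b = ⊥-elim (b≢b refl)
positions-[]=⁺ b i (x ∷ xs) (suc m) (there a) with b ≟ x
... | yes _ = there shifted
  where shifted = subst (positions b (suc i) xs [ count b (take m xs) ]=_) (sym (+-suc i m))
                        (positions-[]=⁺ b (suc i) xs m a)
... | no  _ = subst (positions b (suc i) xs [ count b (take m xs) ]=_) (sym (+-suc i m))
                (positions-[]=⁺ b (suc i) xs m a)

upFrom : ℕ → ℕ → List ℕ
upFrom i zero    = []
upFrom i (suc n) = i ∷ upFrom (suc i) n

map-suc-upTo : ∀ n → map suc (upTo n) ≡ upFrom 1 n
map-suc-upTo n = trans (map-applyUpTo (λ k → k) suc n) (applyUpTo-shift suc 1 n λ _ → refl)
  where
  applyUpTo-shift : ∀ f i n → (∀ k → f k ≡ i + k) → applyUpTo f n ≡ upFrom i n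
  applyUpTo-shift f i zero    f≗ = refl
  applyUpTo-shift f i (suc n) f≗ = cong₂ _∷_ (trans (f≗ 0) (+-identityʳ i))
    (applyUpTo-shift (λ k → f (suc k)) (suc i) n (λ k → trans (f≗ (suc k)) (+-suc i k)))

positions-↭ : ∀ i xs → positions false i xs ++ positions true i xs ↭ upFrom i (length xs)
positions-↭ i []           = ↭-refl
positions-↭ i (false ∷ xs) = prep i (positions-↭ (suc i) xs)
positions-↭ i (true ∷ xs)  =
  ↭-trans (shift i (positions false (suc i) xs) (positions true (suc i) xs))
          (prep i (positions-↭ (suc i) xs))

-- pending holds the first-column entries below i whose rows still lack a second entry.
Ballot⇒rowsIncrease : ∀ {c y} → Ballot c y →
                      ∀ i (pending : List ℕ) → length pending ≡ c → All (_< i) pending →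
                      Prefix _>_ (positions true i y) (pending ++ positions false i y)
Ballot⇒rowsIncrease []     i pending len below = []
Ballot⇒rowsIncrease {c} (0∷_ {w = w} p) i pending len below =
  subst (Prefix _>_ (positions true (suc i) w)) (++-assoc pending [ i ] (positions false (suc i) w))
    (Ballot⇒rowsIncrease p (suc i) (pending ++ [ i ])
      (trans (length-++ pending) (trans (+-comm _ 1) (cong suc len)))
      (All.++⁺ (All.map (λ k<i → ≤-trans k<i (n≤1+n _)) below) (≤-refl ∷ [])))
  where import Data.List.Relation.Unary.All.Properties as All
Ballot⇒rowsIncrease (1∷ p) i (k ∷ pending) refl (k<i ∷ below) =
  k<i ∷ Ballot⇒rowsIncrease p (suc i) pending refl (All.map (λ k<i → ≤-trans k<i (n≤1+n _)) below)

rowsIncrease⇒Ballot : ∀ i pending y → Prefix _>_ (positions true i y) (pending ++ positions false i y) →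
                      Ballot (length pending) y
rowsIncrease⇒Ballot i pending []          _ = []
rowsIncrease⇒Ballot i pending (false ∷ w) p =
  0∷ subst (λ c → Ballot c w) (trans (length-++ pending) (+-comm _ 1))
       (rowsIncrease⇒Ballot (suc i) (pending ++ [ i ]) w
         (subst (Prefix _>_ (positions true (suc i) w)) (sym (++-assoc pending [ i ] _)) p))
rowsIncrease⇒Ballot i [] (true ∷ w) p
  with positions false (suc i) w | positions-≥ false (suc i) w | p
... | _ ∷ _ | i<k ∷ _ | k<i ∷ _ = ⊥-elim (<-asym k<i i<k)
rowsIncrease⇒Ballot i (k ∷ pending) (true ∷ w) (_ ∷ p) = 1∷ rowsIncrease⇒Ballot (suc i) pending w p

Prefix⇒lookup< : ∀ {xs ys} → Prefix _>_ ys xs → (le : length ys ≤ length xs) →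
                 ∀ r → lookup xs (inject≤ r le) < lookup ys r
Prefix⇒lookup< (k<l ∷ _) _  fzero    = k<l
Prefix⇒lookup< (_ ∷ p)   le (fsuc r) = Prefix⇒lookup< p (s≤s⁻¹ le) r

lookup<⇒Prefix : ∀ xs ys (le : length ys ≤ length xs) →
                 (∀ r → lookup xs (inject≤ r le) < lookup ys r) → Prefix _>_ ys xs
lookup<⇒Prefix xs       []       le rows = []
lookup<⇒Prefix (x ∷ xs) (y ∷ ys) le rows =
  rows fzero ∷ lookup<⇒Prefix xs ys (s≤s⁻¹ le) (λ r → rows (fsuc r))

tableau : List Bool → Filling
tableau y = positions false 1 y , positions true 1 y

IsSYT-tableau : ∀ {y} → Ballot 0 y → IsSYT (length y) (tableau y)
IsSYT-tableau {y} p = record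
  { shape     = length-mono rows
  ; entries   = subst (positions false 1 y ++ positions true 1 y ↭_)
                      (sym (map-suc-upTo (length y))) (positions-↭ 1 y)
  ; col1-incr = positions-increasing false 1 y
  ; col2-incr = positions-increasing true 1 y
  ; row-incr  = Prefix⇒lookup< rows (length-mono rows)
  }
  where
  rows : Prefix _>_ (positions true 1 y) (positions false 1 y)
  rows = Ballot⇒rowsIncrease p 1 [] refl []

upFrom-≥ : ∀ i n → All (i ≤_) (upFrom i n)
upFrom-≥ i zero    = []
upFrom-≥ i (suc n) = ≤-refl ∷ All.map (≤-trans (n≤1+n i)) (upFrom-≥ (suc i) n)

upFrom-increasing : ∀ i n → AllPairs _<_ (upFrom i n)
upFrom-increasing i zero    = []
upFrom-increasing i (suc n) = upFrom-≥ (suc i) n ∷ upFrom-increasing (suc i) n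

∈-upFrom⁻ : ∀ i n {v} → v ∈ upFrom i n → ∃[ m ] (v ≡ i + m × m < n)
∈-upFrom⁻ i (suc n) (here refl) = 0 , sym (+-identityʳ i) , s≤s z≤n
∈-upFrom⁻ i (suc n) (there p) with ∈-upFrom⁻ (suc i) n p
... | m , refl , m<n = suc m , sym (+-suc i m) , s≤s m<n

∈-upFrom⁺ : ∀ i n m → m < n → i + m ∈ upFrom i n
∈-upFrom⁺ i (suc n) zero    _         = here (+-identityʳ i)
∈-upFrom⁺ i (suc n) (suc m) (s≤s m<n) =
  there (subst (_∈ upFrom (suc i) n) (sym (+-suc i m)) (∈-upFrom⁺ (suc i) n m m<n))

map-upFrom-[]=⁻ : ∀ {A : Set} (f : ℕ → A) i n {m v} →
                  map f (upFrom i n) [ m ]= v → m < n × f (i + m) ≡ v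
map-upFrom-[]=⁻ f i (suc n)         here      = s≤s z≤n , cong f (+-identityʳ i)
map-upFrom-[]=⁻ f i (suc n) {suc m} (there p) with map-upFrom-[]=⁻ f (suc i) n p
... | m<n , eq = s≤s m<n , trans (cong f (+-suc i m)) eq

map-upFrom-[]=⁺ : ∀ {A : Set} (f : ℕ → A) i n m → m < n → map f (upFrom i n) [ m ]= f (i + m)
map-upFrom-[]=⁺ f i (suc n) zero    _ =
  subst (λ k → map f (upFrom i (suc n)) [ 0 ]= f k) (sym (+-identityʳ i)) here
map-upFrom-[]=⁺ f i (suc n) (suc m) (s≤s m<n) =
  subst (λ k → map f (upFrom i (suc n)) [ suc m ]= f k) (sym (+-suc i m))
    (there (map-upFrom-[]=⁺ f (suc i) n m m<n))

Unique-++⇒disjoint : ∀ {A : Set} (xs : List A) {ys v} → Unique (xs ++ ys) → v ∈ xs → v ∉ ys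
Unique-++⇒disjoint (x ∷ xs) (x∉ ∷ _) (here refl) v∈ys = All.lookup x∉ (∈-++⁺ʳ xs v∈ys) refl
Unique-++⇒disjoint (x ∷ xs) (_ ∷ u)  (there v∈xs) v∈ys = Unique-++⇒disjoint xs u v∈xs v∈ys

increasing-ext : ∀ {xs ys : List ℕ} → AllPairs _<_ xs → AllPairs _<_ ys →
                 (∀ {v} → v ∈ xs → v ∈ ys) → (∀ {v} → v ∈ ys → v ∈ xs) → xs ≡ ys
increasing-ext {[]}     {[]}     _ _ _ _ = refl
increasing-ext {[]}     {y ∷ ys} _ _ _ from with from (here refl)
... | ()
increasing-ext {x ∷ xs} {[]}     _ _ to _ with to (here refl)
... | ()
increasing-ext {x ∷ xs} {y ∷ ys} (x< ∷ xs↑) (y< ∷ ys↑) to from =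
  cong₂ _∷_ x≡y (increasing-ext xs↑ ys↑ to′ from′)
  where
  x≡y : x ≡ y
  x≡y with to (here refl) | from (here refl)
  ... | here eq | _       = eq
  ... | there _ | here eq = sym eq
  ... | there p | there q = ⊥-elim (<-asym (All.lookup y< p) (All.lookup x< q))
  to′ : ∀ {v} → v ∈ xs → v ∈ ys
  to′ p with to (there p)
  ... | here refl = ⊥-elim (<-irrefl x≡y (All.lookup x< p))
  ... | there q   = q
  from′ : ∀ {v} → v ∈ ys → v ∈ xs
  from′ p with from (there p)
  ... | here refl = ⊥-elim (<-irrefl (sym x≡y) (All.lookup y< p))
  ... | there q   = q

wordOf : ℕ → Filling → List Bool
wordOf n t = map (λ v → does (v ∈? col2 t)) (upFrom 1 n)

length-wordOf : ∀ n t → length (wordOf n t) ≡ n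
length-wordOf n t = trans (length-map _ (upFrom 1 n)) (length-upFrom 1 n)
  where
  length-upFrom : ∀ i n → length (upFrom i n) ≡ n
  length-upFrom i zero    = refl
  length-upFrom i (suc n) = cong suc (length-upFrom (suc i) n)

tableau-wordOf : ∀ {n c₁ c₂} → IsSYT n (c₁ , c₂) → tableau (wordOf n (c₁ , c₂)) ≡ (c₁ , c₂)
tableau-wordOf {n} {c₁} {c₂} syt = cong₂ _,_
    (increasing-ext (positions-increasing false 1 y) col1-incr first⊆ ⊆first)
    (increasing-ext (positions-increasing true 1 y) col2-incr second⊆ ⊆second)
  where
  open IsSYT syt
  y = wordOf n (c₁ , c₂)
  entries′ : c₁ ++ c₂ ↭ upFrom 1 n
  entries′ = subst (c₁ ++ c₂ ↭_) (map-suc-upTo n) entries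
  entry : ∀ {v} → v ∈ c₁ ++ c₂ → ∃[ k ] (v ≡ suc k × k < n)
  entry p = ∈-upFrom⁻ 1 n (∈-resp-↭ entries′ p)
  second⊆ : ∀ {v} → v ∈ positions true 1 y → v ∈ c₂
  second⊆ p with positions-[]=⁻ true 1 y (proj₂ (∈⇒[]= p))
  ... | k , refl , a , _ with map-upFrom-[]=⁻ _ 1 n a
  ...   | _ , in₂ with suc k ∈? c₂ | in₂
  ...     | yes q | _  = q
  ...     | no _  | ()
  ⊆second : ∀ {v} → v ∈ c₂ → v ∈ positions true 1 y
  ⊆second p with entry (∈-++⁺ʳ c₁ p)
  ... | k , refl , k<n = []=⇒∈ (positions-[]=⁺ true 1 y k
          (subst (y [ k ]=_) (dec-true (suc k ∈? c₂) p) (map-upFrom-[]=⁺ _ 1 n k k<n)))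
  first⊆ : ∀ {v} → v ∈ positions false 1 y → v ∈ c₁
  first⊆ p with positions-[]=⁻ false 1 y (proj₂ (∈⇒[]= p))
  ... | k , refl , a , _ with map-upFrom-[]=⁻ _ 1 n a
  ...   | k<n , not₂ with ∈-++⁻ c₁ (∈-resp-↭ (↭-sym entries′) (∈-upFrom⁺ 1 n k k<n))
  ...     | inj₁ q = q
  ...     | inj₂ q with suc k ∈? c₂ | not₂
  ...       | yes _ | ()
  ...       | no q∉ | _  = ⊥-elim (q∉ q)
  ⊆first : ∀ {v} → v ∈ c₁ → v ∈ positions false 1 y
  ⊆first p with entry (∈-++⁺ˡ p)
  ... | k , refl , k<n = []=⇒∈ (positions-[]=⁺ false 1 y k
          (subst (y [ k ]=_) (dec-false (suc k ∈? c₂) (Unique-++⇒disjoint c₁ distinct p))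
            (map-upFrom-[]=⁺ _ 1 n k k<n)))
    where
    distinct : Unique (c₁ ++ c₂)
    distinct = Unique-resp-↭ (setoid ℕ) (↭⇒↭ₛ (↭-sym entries′))
                 (AllPairs.map (λ k<l k≡l → <-irrefl k≡l k<l) (upFrom-increasing 1 n))

Ballot-wordOf : ∀ {n c₁ c₂} → IsSYT n (c₁ , c₂) → Ballot 0 (wordOf n (c₁ , c₂))
Ballot-wordOf {n} {c₁} {c₂} syt = rowsIncrease⇒Ballot 1 [] (wordOf n (c₁ , c₂))
  (subst (λ t → Prefix _>_ (col2 t) (col1 t)) (sym (tableau-wordOf syt))
    (lookup<⇒Prefix c₁ c₂ shape row-incr))
  where open IsSYT syt

InRow-tableau⁻ : ∀ y {v r} → InRow (tableau y) v r →
                 ∃[ m ] (v ≡ suc m × ∃[ b ] (y [ m ]= b × count b (take m y) ≡ r))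
InRow-tableau⁻ y (inj₁ p) with positions-[]=⁻ false 1 y (lookup⇒[]= _ p)
... | m , v≡ , a , r≡ = m , v≡ , false , a , r≡
InRow-tableau⁻ y (inj₂ p) with positions-[]=⁻ true 1 y (lookup⇒[]= _ p)
... | m , v≡ , a , r≡ = m , v≡ , true , a , r≡

InRow-tableau⁺ : ∀ y {m b} → y [ m ]= b → InRow (tableau y) (suc m) (count b (take m y))
InRow-tableau⁺ y {m} {false} a = inj₁ ([]=⇒lookup (positions-[]=⁺ false 1 y m a))
InRow-tableau⁺ y {m} {true}  a = inj₂ ([]=⇒lookup (positions-[]=⁺ true 1 y m a))

count-take-suc : ∀ b {y m x} → y [ m ]= x →
                 count b (take (suc m) y) ≡ count b (take m y) + count b [ x ]
count-take-suc b {y} {m} {x} a = trans (cong (count b) (take-suc-[]= a)) (count-++ b (take m y) [ x ])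

Peak-rows : ∀ {y m} → Ballot 0 y → y [ m ]= false → y [ suc m ]= true →
            count true (take (suc m) y) ≤ count false (take m y)
Peak-rows {y} {m} w a a′ = s≤s⁻¹ (begin
  suc (count true (take (suc m) y))              ≡⟨ +-comm 1 _ ⟩
  count true (take (suc m) y) + 1                ≡⟨ sym (count-take-suc true a′) ⟩
  count true (take (suc (suc m)) y)              ≤⟨ Ballot⇒prefixes w (suc (suc m)) ⟩
  count false (take (suc (suc m)) y)             ≡⟨ count-take-suc false a′ ⟩
  count false (take (suc m) y) + 0               ≡⟨ +-identityʳ _ ⟩
  count false (take (suc m) y)                   ≡⟨ count-take-suc false a ⟩
  count false (take m y) + 1                     ≡⟨ +-comm _ 1 ⟩
  suc (count false (take m y))                   ∎)
  where open ≤-Reasoning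

nonPeak-rows : ∀ {y m b b′} → Ballot 0 y → y [ m ]= b → y [ suc m ]= b′ → ¬ Peak y (suc m) →
               count b (take m y) < count b′ (take (suc m) y)
nonPeak-rows {b = false} {true}  w a a′ ¬peak = ⊥-elim (¬peak (a , a′))
nonPeak-rows {b = false} {false} w a a′ _ = ≤-reflexive (sym (trans (count-take-suc false a) (+-comm _ 1)))
nonPeak-rows {b = true}  {true}  w a a′ _ = ≤-reflexive (sym (trans (count-take-suc true a) (+-comm _ 1)))
nonPeak-rows {y} {m} {true} {false} w a a′ _ = begin-strict
  count true (take m y)         <⟨ n<1+n _ ⟩
  suc (count true (take m y))   ≡⟨ +-comm 1 _ ⟩
  count true (take m y) + 1     ≡⟨ sym (count-take-suc true a) ⟩
  count true (take (suc m) y)   ≤⟨ Ballot⇒prefixes w (suc m) ⟩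
  count false (take (suc m) y)  ∎
  where open ≤-Reasoning

IsDescent-tableau⁻ : ∀ {y i} → Ballot 0 y → IsDescent (tableau y) i →
                     1 ≤ i × i < length y × ¬ Peak y i
IsDescent-tableau⁻ {y} w (r , r′ , inRow , inRow′ , r<r′)
  with InRow-tableau⁻ y inRow | InRow-tableau⁻ y inRow′
... | m , refl , b , a , refl | _ , refl , b′ , a′ , refl = s≤s z≤n , []=⇒< a′ , ¬peak
  where
  ¬peak : ¬ Peak y (suc m)
  ¬peak (a₀ , a₁) with []=-functional a a₀ | []=-functional a′ a₁
  ... | refl | refl = <⇒≱ r<r′ (Peak-rows w a a′)

IsDescent-tableau⁺ : ∀ {y i} → Ballot 0 y → 1 ≤ i → i < length y → ¬ Peak y i →
                     IsDescent (tableau y) i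
IsDescent-tableau⁺ {y} {suc m} w (s≤s z≤n) i<n ¬peak
  with <⇒[]= y (≤-trans (n≤1+n _) i<n) | <⇒[]= y i<n
... | b , a | b′ , a′ = _ , _ , InRow-tableau⁺ y a , InRow-tableau⁺ y a′ , nonPeak-rows w a a′ ¬peak

positions-injective : ∀ i y y′ → positions false i y ≡ positions false i y′ →
                      positions true i y ≡ positions true i y′ → y ≡ y′
positions-injective i []          []           _  _  = refl
positions-injective i []          (false ∷ y′) () _
positions-injective i []          (true ∷ y′)  _  ()
positions-injective i (false ∷ y) []           () _
positions-injective i (true ∷ y)  []           _  ()
positions-injective i (false ∷ y) (false ∷ y′) e₀ e₁ =
  cong (false ∷_) (positions-injective (suc i) y y′ (proj₂ (∷-injective e₀)) e₁)
positions-injective i (true ∷ y)  (true ∷ y′)  e₀ e₁ =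
  cong (true ∷_) (positions-injective (suc i) y y′ e₀ (proj₂ (∷-injective e₁)))
positions-injective i (false ∷ y) (true ∷ y′)  e₀ _
  with subst (All (suc i ≤_)) (sym e₀) (positions-≥ false (suc i) y′)
... | i<i ∷ _ = ⊥-elim (<-irrefl refl i<i)
positions-injective i (true ∷ y)  (false ∷ y′) _ e₁
  with subst (All (suc i ≤_)) (sym e₁) (positions-≥ true (suc i) y′)
... | i<i ∷ _ = ⊥-elim (<-irrefl refl i<i)

tableau-injective : ∀ {y y′} → tableau y ≡ tableau y′ → y ≡ y′
tableau-injective {y} {y′} eq = positions-injective 1 y y′ (cong proj₁ eq) (cong proj₂ eq)

-- Descents of the mirrored tableau

reflect-range : ∀ {n k} → 1 ≤ k → k ≤ n ∸ 1 → 1 ≤ n ∸ k × n ∸ k ≤ n ∸ 1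
reflect-range {suc n} {suc k} (s≤s z≤n) k<n = m<n⇒0<n∸m k<n , m∸n≤m n k

reflect-involutive : ∀ {n k} → k ≤ n ∸ 1 → n ∸ (n ∸ k) ≡ k
reflect-involutive {n} k≤ = m∸[m∸n]≡n (≤-trans k≤ (m∸n≤m n 1))

range⇒< : ∀ {n i} → 1 ≤ i → i ≤ n ∸ 1 → i < n
range⇒< {zero}  (s≤s _) ()
range⇒< {suc n} _       i≤n = s≤s i≤n

<⇒range : ∀ {n i} → i < n → i ≤ n ∸ 1
<⇒range (s≤s i≤n) = i≤n

Peak-mirror : ∀ {h w n} → HalfDyck h w → length w ≡ n →
              ∀ {k} → 1 ≤ k → k ≤ n ∸ 1 → Peak (mirror w) k ⇔ Peak w (n ∸ k)
Peak-mirror {w = w} {n} p len {k} 1≤k k≤ = mk⇔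
  (Peak-reflect (peakMarks-mirror p) len 1≤k k≤)
  (λ peak → subst (Peak (mirror w)) (reflect-involutive k≤)
     (Peak-reflect marks≡ (trans (length-mirror p) len) 1≤k′ k′≤ peak))
  where
  1≤k′ = proj₁ (reflect-range 1≤k k≤)
  k′≤  = proj₂ (reflect-range 1≤k k≤)
  marks≡ : peakMarks w ≡ reverse (peakMarks (mirror w))
  marks≡ = trans (sym (reverse-involutive (peakMarks w))) (cong reverse (sym (peakMarks-mirror p)))

IsDescent-tableau⇔ : ∀ {y n} → Ballot 0 y → length y ≡ n →
                     ∀ {i} → 1 ≤ i → i ≤ n ∸ 1 → IsDescent (tableau y) i ⇔ (¬ Peak y i)
IsDescent-tableau⇔ b len 1≤i i≤ = mk⇔
  (λ d → proj₂ (proj₂ (IsDescent-tableau⁻ b d)))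
  (IsDescent-tableau⁺ b 1≤i (subst (_ <_) (sym len) (range⇒< 1≤i i≤)))

IsDescent-tableau-range : ∀ {y n} → Ballot 0 y → length y ≡ n →
                          ∀ {i} → IsDescent (tableau y) i → 1 ≤ i × i ≤ n ∸ 1
IsDescent-tableau-range b len d with IsDescent-tableau⁻ b d
... | 1≤i , i<n , _ = 1≤i , <⇒range (subst (_ <_) len i<n)

IsDescent-mirror⇔ : ∀ {h w n} → HalfDyck h w → length w ≡ n → ∀ {i} → 1 ≤ i → i ≤ n ∸ 1 →
                    IsDescent (tableau (mirror w)) i ⇔ (¬ Has01At w (n ∸ i))
IsDescent-mirror⇔ {w = w} {n} p len {i} 1≤i i≤ = mk⇔
  (λ d h → to descent d (from peak (to (Has01At⇔Peak w (n ∸ i)) h)))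
  (λ ¬h → from descent λ pk → ¬h (from (Has01At⇔Peak w (n ∸ i)) (to peak pk)))
  where
  descent = IsDescent-tableau⇔ (HalfDyck⇒Ballot (HalfDyck-mirror p) 0) (trans (length-mirror p) len) 1≤i i≤
  peak    = Peak-mirror p len 1≤i i≤

Has01At⇔descents : ∀ {n h w} {D : List ℕ} → All (λ d → 1 ≤ d × d ≤ n ∸ 1) D →
                   HalfDyck h w → length w ≡ n →
                   (∀ k → 1 ≤ k → k ≤ n ∸ 1 → (Has01At w k ⇔ n ∸ k ∉ D)) ⇔
                   (∀ i → i ∈ D ⇔ IsDescent (tableau (mirror w)) i)
Has01At⇔descents {n} {w = w} {D} D⊆ p len = mk⇔ toDescents toFactors
  where
  descent = IsDescent-mirror⇔ p len
  toDescents : (∀ k → 1 ≤ k → k ≤ n ∸ 1 → (Has01At w k ⇔ n ∸ k ∉ D)) →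
               ∀ i → i ∈ D ⇔ IsDescent (tableau (mirror w)) i
  toDescents factors i = mk⇔
    (λ i∈D → let 1≤i , i≤ = All.lookup D⊆ i∈D ; 1≤k , k≤ = reflect-range 1≤i i≤ in
      from (descent 1≤i i≤) λ h →
        to (factors (n ∸ i) 1≤k k≤) h (subst (_∈ D) (sym (reflect-involutive i≤)) i∈D))
    (λ d → let 1≤i , i≤ = range d ; 1≤k , k≤ = reflect-range 1≤i i≤ in
      decidable-stable (i ∈? D) λ i∉D →
        to (descent 1≤i i≤) d
          (from (factors (n ∸ i) 1≤k k≤) (subst (_∉ D) (sym (reflect-involutive i≤)) i∉D)))
    where
    range =
      IsDescent-tableau-range (HalfDyck⇒Ballot (HalfDyck-mirror p) 0) (trans (length-mirror p) len)
  toFactors : (∀ i → i ∈ D ⇔ IsDescent (tableau (mirror w)) i) →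
              ∀ k → 1 ≤ k → k ≤ n ∸ 1 → Has01At w k ⇔ n ∸ k ∉ D
  toFactors descents k 1≤k k≤ = mk⇔
    (λ h i∈D → to (descent 1≤i i≤) (to (descents (n ∸ k)) i∈D)
                 (subst (Has01At w) (sym (reflect-involutive k≤)) h))
    (λ i∉D → subst (Has01At w) (reflect-involutive k≤)
      (decidable-stable (Has01At? w (n ∸ (n ∸ k))) λ ¬h →
        i∉D (from (descents (n ∸ k)) (from (descent 1≤i i≤) ¬h))))
    where
    1≤i = proj₁ (reflect-range 1≤k k≤)
    i≤  = proj₂ (reflect-range 1≤k k≤)

words : ℕ → List (List Bool)
words zero    = [ [] ]
words (suc n) = map (false ∷_) (words n) ++ map (true ∷_) (words n)

∈-words⁺ : ∀ n w → length w ≡ n → w ∈ words n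
∈-words⁺ zero    []          _   = here refl
∈-words⁺ (suc n) (false ∷ w) len = ∈-++⁺ˡ (∈-map⁺ (false ∷_) (∈-words⁺ n w (suc-injective len)))
∈-words⁺ (suc n) (true ∷ w)  len =
  ∈-++⁺ʳ (map (false ∷_) (words n)) (∈-map⁺ (true ∷_) (∈-words⁺ n w (suc-injective len)))

words-unique : ∀ n → Unique (words n)
words-unique zero    = [] ∷ []
words-unique (suc n) =
  Unique.++⁺ (Unique.map⁺ ∷-injectiveʳ (words-unique n)) (Unique.map⁺ ∷-injectiveʳ (words-unique n)) disjoint
  where
  disjoint : ∀ {v} → ¬ (v ∈ map (false ∷_) (words n) × v ∈ map (true ∷_) (words n))
  disjoint (p , q) with ∈-map⁻ (false ∷_) p | ∈-map⁻ (true ∷_) q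
  ... | _ , _ , refl | _ , _ , ()

Unique-map⁺ : ∀ {A B : Set} {P : A → Set} (f : A → B) {xs} →
              (∀ {x y} → P x → P y → f x ≡ f y → x ≡ y) → All P xs → Unique xs → Unique (map f xs)
Unique-map⁺ f inj []         []          = []
Unique-map⁺ {P = P} f {x ∷ xs} inj (px ∷ pxs) (x∉ ∷ u) = images x∉ pxs ∷ Unique-map⁺ f inj pxs u
  where
  images : ∀ {zs} → All (λ z → ¬ x ≡ z) zs → All P zs → All (λ z → ¬ f x ≡ z) (map f zs)
  images []          []          = []
  images (x≢z ∷ x≢s) (pz ∷ pzs) = (λ fx≡fz → x≢z (inj px pz fx≡fz)) ∷ images x≢s pzs

IsCatalanHalfWord⇔Ballot : ∀ n w → IsCatalanHalfWord n w ⇔ (length w ≡ n × Ballot 0 w)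
IsCatalanHalfWord⇔Ballot n w =
  mk⇔ (λ (len , pre) → len , prefixes⇒Ballot 0 w pre) (λ (len , b) → len , Ballot⇒prefixes b)

_⇔?_ : ∀ {A B : Set} → Dec A → Dec B → Dec (A ⇔ B)
a? ⇔? b? = map′ (uncurry mk⇔) (λ e → to e , from e) ((a? →-dec b?) ×-dec (b? →-dec a?))

InCWD? : ∀ n j D w → Dec (InCWD n j D w)
InCWD? n j D w =
  map′ (from (IsCatalanHalfWord⇔Ballot n w)) (to (IsCatalanHalfWord⇔Ballot n w))
       ((length w ℕ.≟ n) ×-dec Ballot? 0 w)
  ×-dec ones w ℕ.≟ j
  ×-dec map′ (λ all k 1≤k k≤ → all {k} (s≤s k≤) 1≤k k≤) (λ all {k} _ → all k)
          (allUpTo? (λ k → 1 ≤? k →-dec k ≤? n ∸ 1 →-dec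
                       (Has01At? w k ⇔? ¬? (n ∸ k ∈? D)))
                    (suc (n ∸ 1)))

module Bijection (n j : ℕ) (D : List ℕ) (D⊆ : All (λ d → 1 ≤ d × d ≤ n ∸ 1) D) where

  toTableau : List Bool → Filling
  toTableau w = tableau (mirror w)

  InCWD⇒HalfDyck : ∀ {w} → InCWD n j D w → ∃[ h ] HalfDyck h w
  InCWD⇒HalfDyck {w} ((_ , pre) , _) = Ballot⇒HalfDyck (prefixes⇒Ballot 0 w pre)

  toTableau-InTD : ∀ {w} → InCWD n j D w → InTD n j D (toTableau w)
  toTableau-InTD {w} cw@((len , _) , ones≡ , factors) =
    subst (λ m → IsSYT m (toTableau w)) (trans (length-mirror p) len)
      (IsSYT-tableau (HalfDyck⇒Ballot (HalfDyck-mirror p) 0)) ,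
    trans (length-positions true 1 (mirror w)) (trans (count-mirror true p) ones≡) ,
    to (Has01At⇔descents D⊆ p len) factors
    where p = proj₂ (InCWD⇒HalfDyck cw)

  InTD⇒toTableau : ∀ {t} → InTD n j D t → ∃[ w ] (InCWD n j D w × toTableau w ≡ t)
  InTD⇒toTableau {t@(c₁ , c₂)} (syt , col2≡ , descents) =
    w ,
    ((len , Ballot⇒prefixes (HalfDyck⇒Ballot q 0)) , ones≡ , from (Has01At⇔descents D⊆ q len) descents′) ,
    toTableau-w
    where
    y = wordOf n t
    p = proj₂ (Ballot⇒HalfDyck (Ballot-wordOf syt))
    w = mirror y
    q = HalfDyck-mirror p
    toTableau-w : toTableau w ≡ t
    toTableau-w = trans (cong tableau (mirror-involutive p)) (tableau-wordOf syt)
    len : length w ≡ n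
    len = trans (length-mirror p) (length-wordOf n t)
    ones≡ : ones w ≡ j
    ones≡ = trans (count-mirror true p)
      (trans (sym (length-positions true 1 y))
        (trans (cong (λ t → length (col2 t)) (tableau-wordOf syt)) col2≡))
    descents′ : ∀ i → i ∈ D ⇔ IsDescent (tableau (mirror w)) i
    descents′ i = subst (λ t → i ∈ D ⇔ IsDescent t i) (sym toTableau-w) (descents i)

  toTableau-injective : ∀ {w w′} → InCWD n j D w → InCWD n j D w′ →
                        toTableau w ≡ toTableau w′ → w ≡ w′
  toTableau-injective {w} {w′} cw cw′ eq = begin
    w                    ≡⟨ mirror-involutive p ⟨
    mirror (mirror w)    ≡⟨ cong mirror (tableau-injective {mirror w} {mirror w′} eq) ⟩
    mirror (mirror w′)   ≡⟨ mirror-involutive p′ ⟩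
    w′                   ∎
    where
    p  = proj₂ (InCWD⇒HalfDyck cw)
    p′ = proj₂ (InCWD⇒HalfDyck cw′)
    open ≡-Reasoning

  halfWords : List (List Bool)
  halfWords = filter (InCWD? n j D) (words n)

  ∈-halfWords : ∀ w → (w ∈ halfWords) ⇔ InCWD n j D w
  ∈-halfWords w = mk⇔ (λ w∈ → proj₂ (∈-filter⁻ (InCWD? n j D) {xs = words n} w∈))
                      (λ cw → ∈-filter⁺ (InCWD? n j D) (∈-words⁺ n w (proj₁ (proj₁ cw))) cw)

  halfWords-unique : Unique halfWords
  halfWords-unique = Unique.filter⁺ (InCWD? n j D) (words-unique n)

  ∈-tableaux : ∀ t → (t ∈ map toTableau halfWords) ⇔ InTD n j D t
  ∈-tableaux t = mk⇔ fromList toList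
    where
    fromList : t ∈ map toTableau halfWords → InTD n j D t
    fromList t∈ with ∈-map⁻ toTableau t∈
    ... | w , w∈ , refl = toTableau-InTD (to (∈-halfWords w) w∈)
    toList : InTD n j D t → t ∈ map toTableau halfWords
    toList td with InTD⇒toTableau td
    ... | w , cw , refl = ∈-map⁺ toTableau (from (∈-halfWords w) cw)

  tableaux-unique : Unique (map toTableau halfWords)
  tableaux-unique = Unique-map⁺ toTableau toTableau-injective
    (All.tabulate (λ {w} → to (∈-halfWords w))) halfWords-unique

lemma1 : (n j : ℕ) → 1 ≤ n → (D : List ℕ) →
         All (λ d → 1 ≤ d × d ≤ n ∸ 1) D →
         ∃[ k ] (HasCard (InTD n j D) k × HasCard (InCWD n j D) k)
lemma1 n j _ D D⊆ =
  length halfWords ,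
  (map toTableau halfWords , tableaux-unique , ∈-tableaux , length-map toTableau halfWords) ,
  (halfWords , halfWords-unique , ∈-halfWords , refl)
  where open Bijection n j D D⊆
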